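{- For every positive integer $n$, \[ \sum_{j=1}^{n}|K_j|\le\sum_{i=1}^{\lceil 3^{n/3}\rceil}\binom{i+n}{n}. \]
   Context: An expression is a formal term built from the symbol $x$ using the binary operations $+$ and $\cdot$ (with parentheses); its size is the number of occurrences of $x$ in it, and its value is the polynomial in $\mathbb{Z}[x]$ it computes. The values of expressions are exactly the nonzero polynomials with nonnegative integer coefficients and zero constant term. For such a polynomial $f$, its complexity $||f||$ is the minimum size of an expression whose value is $f$. For $n\ge1$, $K_n$ is the set of such polynomials $f$ with $||f||=n$. -}

module Defs where

open import Data.Nat using (ℕ; zero; suc; _+_; _*_; _^_; _≤_)
open import Data.Nat.Combinatorics using (_C_)
open import Data.List using (List; []; _∷_; map; length)
open import Data.List.Membership.Propositional using (_∈_)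
open import Data.List.Relation.Unary.Unique.Propositional using (Unique)
open import Data.Product using (Σ; _×_; ∃)
open import Function.Bundles using (_⇔_)
open import Relation.Binary.PropositionalEquality using (_≡_)

data Expr : Set where
  var  : Expr
  _⊕_  : Expr → Expr → Expr
  _⊗_  : Expr → Expr → Expr

size : Expr → ℕ
size var       = 1
size (e ⊕ e')  = size e + size e'
size (e ⊗ e')  = size e + size e'

-- Polynomials with nonnegative integer coefficients, as dense coefficient
-- lists [a₀, a₁, a₂, …] (coefficient of x^i at position i).
-- Canonical form: no trailing zeros (so polynomial equality is _≡_).
Poly : Set
Poly = List ℕ

addP : Poly → Poly → Poly
addP []       q        = q
addP (a ∷ p)  []       = a ∷ p
addP (a ∷ p)  (b ∷ q)  = (a + b) ∷ addP p q

mulP : Poly → Poly → Poly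
mulP []       q = []
mulP (a ∷ p)  q = addP (map (a *_) q) (0 ∷ mulP p q)

norm : Poly → Poly
norm [] = []
norm (a ∷ p) with norm p
... | []      with a
...   | zero  = []
...   | suc k = suc k ∷ []
norm (a ∷ p) | b ∷ r = a ∷ b ∷ r

eval : Expr → Poly
eval var       = 0 ∷ 1 ∷ []
eval (e ⊕ e')  = norm (addP (eval e) (eval e'))
eval (e ⊗ e')  = norm (mulP (eval e) (eval e'))

-- f ∈ K_n  :⇔  ||f|| = n, i.e. some expression of size n has value f and
-- every expression with value f has size ≥ n.
InK : ℕ → Poly → Set
InK n f = (∃ λ e → size e ≡ n × eval e ≡ f) × (∀ e → eval e ≡ f → n ≤ size e)

-- L lists the elements of the set P exactly once each (so |P| = length L).
Enumerates : List Poly → (Poly → Set) → Set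
Enumerates L P = Unique L × (∀ f → (f ∈ L) ⇔ P f)

-- c = ⌈ m^(1/3) ⌉  (least natural number whose cube is ≥ m)
IsCeilCubeRoot : ℕ → ℕ → Set
IsCeilCubeRoot m c = m ≤ c ^ 3 × (∀ d → m ≤ d ^ 3 → c ≤ d)

sum1to : ℕ → (ℕ → ℕ) → ℕ
sum1to zero    f = 0
sum1to (suc k) f = sum1to k f + f (suc k)

-- An expression of size m has value f with f(1)³ ≤ 3^m, where f(1) is the coefficient sum:
-- products multiply both sides, and for sums a + b ≤ a b once a, b ≥ 2, while adding 1 to a
-- costs a factor 3 whenever a³ ≤ 3^s with s ≥ 1. So every f of complexity at most n has zero
-- constant term, degree at most n and f(1) ≤ c, and is therefore determined by its coefficients
-- of x, …, xⁿ: an n-tuple with sum at most c. There are (c + n) C n such tuples, which is the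
-- last term of the right-hand side, and the classes K_j are disjoint. Each K_j is enumerated by
-- evaluating the expressions of size j and discarding values reached by smaller expressions.
module Submission where

open import Defs
open import Data.Nat
open import Data.Nat.Properties
open import Data.Nat.Combinatorics using (_C_; nCn≡1; nCk+nC[k+1]≡[n+1]C[k+1])
open import Data.Nat.ListAction using (sum)
open import Data.Nat.Tactic.RingSolver using (solve-∀)
open import Algebra.Properties.CommutativeSemiring.Exp +-*-commutativeSemiring using (^-distrib-*)
open import Data.List using (List; []; _∷_; map; length; _++_; filter; deduplicate; cartesianProductWith)
open import Data.List.Properties using (length-map; length-++; ≡-dec)
open import Data.List.Membership.Propositional using (_∈_)
open import Data.List.Membership.Propositional.Properties
  using (∈-map⁺; ∈-++⁺ˡ; ∈-++⁺ʳ; ∈-++⁻; ∈-∃++; ∈-cartesianProductWith⁺; ∈-filter⁺; ∈-filter⁻;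
         ∈-map∘filter⁺; ∈-map∘filter⁻; ∈-deduplicate⁺; ∈-deduplicate⁻)
open import Data.List.Relation.Binary.Subset.Propositional using (_⊆_)
open import Data.List.Relation.Unary.Any using (here; there)
import Data.List.Relation.Unary.All as All
open import Data.List.Relation.Unary.AllPairs using ([]; _∷_)
open import Data.List.Relation.Unary.Unique.Propositional using (Unique)
open import Data.List.Relation.Unary.Unique.Propositional.Properties using (++⁺)
open import Data.Product using (Σ; _×_; _,_; ∃; proj₁; proj₂)
open import Data.Sum using (inj₁; inj₂)
open import Data.Unit using (⊤; tt)
open import Function.Bundles using (mk⇔; Equivalence)
open import Relation.Binary.Definitions using (DecidableEquality)
open import Relation.Binary.PropositionalEquality
open import Relation.Nullary using (¬_; yes; no; ¬?; contradiction)

_≟ₚ_ : DecidableEquality Poly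
_≟ₚ_ = ≡-dec _≟_

open import Data.List.Membership.DecPropositional _≟ₚ_ using (_∈?_)
open import Data.List.Relation.Unary.Unique.DecPropositional.Properties _≟ₚ_ using (deduplicate-!)

infixr 5 _∷ₙ_

_∷ₙ_ : ℕ → Poly → Poly
a     ∷ₙ b ∷ p = a ∷ b ∷ p
zero  ∷ₙ []    = []
suc k ∷ₙ []    = suc k ∷ []

norm-∷ : ∀ a p → norm (a ∷ p) ≡ a ∷ₙ norm p
norm-∷ a p with norm p
... | [] with a
...   | zero  = refl
...   | suc k = refl
norm-∷ a p | b ∷ r = refl

norm-∷ₙ : ∀ a p → norm (a ∷ₙ p) ≡ a ∷ₙ norm p
norm-∷ₙ a       (b ∷ p) = norm-∷ a (b ∷ p)
norm-∷ₙ zero    []      = refl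
norm-∷ₙ (suc k) []      = refl

norm-idem : ∀ p → norm (norm p) ≡ norm p
norm-idem []      = refl
norm-idem (a ∷ p) rewrite norm-∷ a p | norm-∷ₙ a (norm p) | norm-idem p = refl

eval-normal : ∀ e → norm (eval e) ≡ eval e
eval-normal var      = refl
eval-normal (e ⊕ e') = norm-idem (addP (eval e) (eval e'))
eval-normal (e ⊗ e') = norm-idem (mulP (eval e) (eval e'))

size>0 : ∀ e → size e > 0
size>0 var      = s≤s z≤n
size>0 (e ⊕ e') = ≤-trans (size>0 e) (m≤m+n _ _)
size>0 (e ⊗ e') = ≤-trans (size>0 e) (m≤m+n _ _)

sum-∷ₙ : ∀ a p → sum (a ∷ₙ p) ≡ a + sum p
sum-∷ₙ a       (b ∷ p) = refl
sum-∷ₙ zero    []      = refl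
sum-∷ₙ (suc k) []      = refl

sum-norm : ∀ p → sum (norm p) ≡ sum p
sum-norm []      = refl
sum-norm (a ∷ p) rewrite norm-∷ a p | sum-∷ₙ a (norm p) | sum-norm p = refl

sum-addP : ∀ p q → sum (addP p q) ≡ sum p + sum q
sum-addP []      q       = refl
sum-addP (a ∷ p) []      = sym (+-identityʳ _)
sum-addP (a ∷ p) (b ∷ q) rewrite sum-addP p q = interchange a b (sum p) (sum q)
  where
  interchange : ∀ a b x y → a + b + (x + y) ≡ a + x + (b + y)
  interchange = solve-∀

sum-map-* : ∀ a q → sum (map (a *_) q) ≡ a * sum q
sum-map-* a []      = sym (*-zeroʳ a)
sum-map-* a (b ∷ q) rewrite sum-map-* a q = sym (*-distribˡ-+ a b (sum q))

sum-mulP : ∀ p q → sum (mulP p q) ≡ sum p * sum q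
sum-mulP []      q = refl
sum-mulP (a ∷ p) q
  rewrite sum-addP (map (a *_) q) (0 ∷ mulP p q) | sum-map-* a q | sum-mulP p q
  = sym (*-distribʳ-+ (sum q) a (sum p))

sum-eval-⊕ : ∀ e e' → sum (eval (e ⊕ e')) ≡ sum (eval e) + sum (eval e')
sum-eval-⊕ e e' = trans (sum-norm (addP (eval e) (eval e'))) (sum-addP (eval e) (eval e'))

sum-eval-⊗ : ∀ e e' → sum (eval (e ⊗ e')) ≡ sum (eval e) * sum (eval e')
sum-eval-⊗ e e' = trans (sum-norm (mulP (eval e) (eval e'))) (sum-mulP (eval e) (eval e'))

-- The ring solver does not handle _^_, so cubes are written out as x * (x * (x * 1)).
cube-suc≤3*cube : ∀ k → (4 + k) ^ 3 ≤ 3 * (3 + k) ^ 3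
cube-suc≤3*cube k = subst ((4 + k) ^ 3 ≤_) (sym (expand k)) (m≤m+n _ _)
  where
  expand : ∀ k → 3 * ((3 + k) * ((3 + k) * ((3 + k) * 1)))
               ≡ (4 + k) * ((4 + k) * ((4 + k) * 1)) + (17 + 33 * k + 15 * (k * k) + 2 * (k * (k * k)))
  expand = solve-∀

cube-suc-≤ : ∀ a s → s > 0 → a ^ 3 ≤ 3 ^ s → (1 + a) ^ 3 ≤ 3 ^ suc s
cube-suc-≤ 0                   s             _ _ = m^n>0 3 (suc s)
cube-suc-≤ 1                   (suc s)       _ _ = ≤-trans (n≤1+n 8) (*-monoʳ-≤ 3 (*-monoʳ-≤ 3 (m^n>0 3 s)))
cube-suc-≤ 2                   1             _ (s≤s (s≤s (s≤s ())))
cube-suc-≤ 2                   (suc (suc s)) _ _ = *-monoʳ-≤ 3 (*-monoʳ-≤ 3 (*-monoʳ-≤ 3 (m^n>0 3 s)))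
cube-suc-≤ (suc (suc (suc k))) s             _ h = ≤-trans (cube-suc≤3*cube k) (*-monoʳ-≤ 3 h)

cube-*-≤ : ∀ a b s t → a ^ 3 ≤ 3 ^ s → b ^ 3 ≤ 3 ^ t → (a * b) ^ 3 ≤ 3 ^ (s + t)
cube-*-≤ a b s t ha hb = begin
  (a * b) ^ 3     ≡⟨ ^-distrib-* a b 3 ⟩
  a ^ 3 * b ^ 3   ≤⟨ *-mono-≤ ha hb ⟩
  3 ^ s * 3 ^ t   ≡⟨ ^-distribˡ-+-* 3 s t ⟨
  3 ^ (s + t)     ∎
  where open ≤-Reasoning

m+n≤m*n : ∀ {m n} → m ≥ 2 → n ≥ 2 → m + n ≤ m * n
m+n≤m*n {suc (suc m)} {suc (suc n)} (s≤s (s≤s _)) (s≤s (s≤s _)) =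
  subst (2 + m + (2 + n) ≤_) (sym (expand m n)) (m≤m+n _ _)
  where
  expand : ∀ m n → (2 + m) * (2 + n) ≡ (2 + m + (2 + n)) + (m + n + m * n)
  expand = solve-∀

cube-+-small-≤ : ∀ a b s t → b ≤ 1 → s > 0 → t > 0 → a ^ 3 ≤ 3 ^ s → (a + b) ^ 3 ≤ 3 ^ (s + t)
cube-+-small-≤ a 0 s t _         _   _   ha = subst (λ x → x ^ 3 ≤ 3 ^ (s + t)) (sym (+-identityʳ a))
  (≤-trans ha (^-monoʳ-≤ 3 (m≤m+n s t)))
cube-+-small-≤ a 1 s t _         s>0 t>0 ha = subst (λ x → x ^ 3 ≤ 3 ^ (s + t)) (+-comm 1 a) (begin
  (1 + a) ^ 3   ≤⟨ cube-suc-≤ a s s>0 ha ⟩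
  3 ^ suc s     ≤⟨ ^-monoʳ-≤ 3 (subst (_≤ s + t) (+-comm s 1) (+-monoʳ-≤ s t>0)) ⟩
  3 ^ (s + t)   ∎)
  where open ≤-Reasoning
cube-+-small-≤ a (suc (suc _)) s t (s≤s ()) _ _ _

cube-+-≤ : ∀ a b s t → s > 0 → t > 0 → a ^ 3 ≤ 3 ^ s → b ^ 3 ≤ 3 ^ t → (a + b) ^ 3 ≤ 3 ^ (s + t)
cube-+-≤ a b s t s>0 t>0 ha hb with b ≤? 1 | a ≤? 1
... | yes b≤1 | _       = cube-+-small-≤ a b s t b≤1 s>0 t>0 ha
... | no _    | yes a≤1 = subst₂ _≤_ (cong (_^ 3) (+-comm b a)) (cong (3 ^_) (+-comm t s))
                            (cube-+-small-≤ b a t s a≤1 t>0 s>0 hb)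
... | no b≰1  | no a≰1  = ≤-trans (^-monoˡ-≤ 3 (m+n≤m*n (≰⇒> a≰1) (≰⇒> b≰1))) (cube-*-≤ a b s t ha hb)

sum-eval-cube-≤ : ∀ e → sum (eval e) ^ 3 ≤ 3 ^ size e
sum-eval-cube-≤ var = s≤s z≤n
sum-eval-cube-≤ (e ⊕ e') rewrite sum-eval-⊕ e e' =
  cube-+-≤ (sum (eval e)) (sum (eval e')) (size e) (size e') (size>0 e) (size>0 e')
    (sum-eval-cube-≤ e) (sum-eval-cube-≤ e')
sum-eval-cube-≤ (e ⊗ e') rewrite sum-eval-⊗ e e' =
  cube-*-≤ (sum (eval e)) (sum (eval e')) (size e) (size e') (sum-eval-cube-≤ e) (sum-eval-cube-≤ e')

cube-cancel-≤ : ∀ {a c} → a ^ 3 ≤ c ^ 3 → a ≤ c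
cube-cancel-≤ h = ≮⇒≥ (λ c<a → <⇒≱ (^-monoˡ-< 3 c<a) h)

length-∷ₙ : ∀ a p → length (a ∷ₙ p) ≤ suc (length p)
length-∷ₙ a       (b ∷ p) = ≤-refl
length-∷ₙ zero    []      = z≤n
length-∷ₙ (suc k) []      = ≤-refl

length-norm : ∀ p → length (norm p) ≤ length p
length-norm []      = z≤n
length-norm (a ∷ p) rewrite norm-∷ a p = ≤-trans (length-∷ₙ a (norm p)) (s≤s (length-norm p))

length-addP : ∀ {k} p q → length p ≤ k → length q ≤ k → length (addP p q) ≤ k
length-addP []      q       _         hq        = hq
length-addP (a ∷ p) []      hp        _         = hp
length-addP (a ∷ p) (b ∷ q) (s≤s hp) (s≤s hq) = s≤s (length-addP p q hp hq)

length-mulP : ∀ {i j} p q → length p ≤ i → length q ≤ suc j → length (mulP p q) ≤ i + j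
length-mulP             []      q _        _  = z≤n
length-mulP {suc i} {j} (a ∷ p) q (s≤s hp) hq = length-addP (map (a *_) q) (0 ∷ mulP p q)
  (subst (_≤ suc (i + j)) (sym (length-map (a *_) q)) (≤-trans hq (s≤s (m≤n+m j i))))
  (s≤s (length-mulP p q hp hq))

length-eval : ∀ e → length (eval e) ≤ suc (size e)
length-eval var      = ≤-refl
length-eval (e ⊕ e') = ≤-trans (length-norm (addP (eval e) (eval e')))
  (length-addP (eval e) (eval e') (≤-trans (length-eval e) (s≤s (m≤m+n _ _)))
                                  (≤-trans (length-eval e') (s≤s (m≤n+m _ _))))
length-eval (e ⊗ e') = ≤-trans (length-norm (mulP (eval e) (eval e')))
  (length-mulP (eval e) (eval e') (length-eval e) (length-eval e'))

ConstantFree : Poly → Set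
ConstantFree []      = ⊤
ConstantFree (a ∷ _) = a ≡ 0

constantFree-norm : ∀ p → ConstantFree p → ConstantFree (norm p)
constantFree-norm []       _    = tt
constantFree-norm (.0 ∷ p) refl rewrite norm-∷ 0 p with norm p
... | []    = tt
... | _ ∷ _ = refl

constantFree-addP : ∀ p q → ConstantFree p → ConstantFree q → ConstantFree (addP p q)
constantFree-addP []       q        _    hq   = hq
constantFree-addP (a ∷ p)  []       hp   _    = hp
constantFree-addP (.0 ∷ p) (.0 ∷ q) refl refl = refl

constantFree-mulP : ∀ p q → ConstantFree p → ConstantFree (mulP p q)
constantFree-mulP []       q       _    = tt
constantFree-mulP (.0 ∷ p) []      refl = refl
constantFree-mulP (.0 ∷ p) (b ∷ q) refl = refl

constantFree-eval : ∀ e → ConstantFree (eval e)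
constantFree-eval var      = refl
constantFree-eval (e ⊕ e') = constantFree-norm (addP (eval e) (eval e'))
  (constantFree-addP (eval e) (eval e') (constantFree-eval e) (constantFree-eval e'))
constantFree-eval (e ⊗ e') = constantFree-norm (mulP (eval e) (eval e'))
  (constantFree-mulP (eval e) (eval e') (constantFree-eval e))

padTo : ℕ → List ℕ → List ℕ
padTo zero    _       = []
padTo (suc k) []      = 0 ∷ padTo k []
padTo (suc k) (x ∷ v) = x ∷ padTo k v

length-padTo : ∀ k v → length (padTo k v) ≡ k
length-padTo zero    v       = refl
length-padTo (suc k) []      = cong suc (length-padTo k [])
length-padTo (suc k) (x ∷ v) = cong suc (length-padTo k v)

sum-padTo-≤ : ∀ k v → sum (padTo k v) ≤ sum v
sum-padTo-≤ zero    v       = z≤n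
sum-padTo-≤ (suc k) []      = sum-padTo-≤ k []
sum-padTo-≤ (suc k) (x ∷ v) = +-monoʳ-≤ x (sum-padTo-≤ k v)

norm-padTo : ∀ {k} v → length v ≤ k → norm (padTo k v) ≡ norm v
norm-padTo {zero}  []      _ = refl
norm-padTo {suc k} []      _ rewrite norm-∷ 0 (padTo k []) | norm-padTo {k} [] z≤n = refl
norm-padTo {suc k} (x ∷ v) (s≤s h) rewrite norm-∷ x (padTo k v) | norm-∷ x v | norm-padTo v h = refl

fromCoefficients : List ℕ → Poly
fromCoefficients v = norm (0 ∷ v)

fromCoefficients-padTo : ∀ {k} v → length v ≤ k → fromCoefficients (padTo k v) ≡ fromCoefficients v
fromCoefficients-padTo {k} v h = begin
  norm (0 ∷ padTo k v)   ≡⟨ norm-∷ 0 (padTo k v) ⟩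
  0 ∷ₙ norm (padTo k v)  ≡⟨ cong (0 ∷ₙ_) (norm-padTo v h) ⟩
  0 ∷ₙ norm v            ≡⟨ norm-∷ 0 v ⟨
  norm (0 ∷ v)           ∎
  where open ≡-Reasoning

incrementHead : List ℕ → List ℕ
incrementHead []      = []
incrementHead (x ∷ v) = suc x ∷ v

-- Tuples with positive first entry are the increments of tuples of smaller sum: Pascal's rule.
boundedTuples : ℕ → ℕ → List (List ℕ)
boundedTuples zero    s       = [] ∷ []
boundedTuples (suc k) zero    = map (0 ∷_) (boundedTuples k zero)
boundedTuples (suc k) (suc s) = map (0 ∷_) (boundedTuples k (suc s)) ++ map incrementHead (boundedTuples (suc k) s)

∈-boundedTuples : ∀ v {s} → sum v ≤ s → v ∈ boundedTuples (length v) s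
∈-boundedTuples []                  _       = here refl
∈-boundedTuples (zero ∷ v)  {zero}  h       = ∈-map⁺ (0 ∷_) (∈-boundedTuples v h)
∈-boundedTuples (zero ∷ v)  {suc s} h       = ∈-++⁺ˡ (∈-map⁺ (0 ∷_) (∈-boundedTuples v h))
∈-boundedTuples (suc x ∷ v) {suc s} (s≤s h) = ∈-++⁺ʳ _ (∈-map⁺ incrementHead (∈-boundedTuples (x ∷ v) h))
∈-boundedTuples (suc x ∷ v) {zero}  ()

length-boundedTuples : ∀ k s → length (boundedTuples k s) ≡ (s + k) C k
length-boundedTuples zero    s       = refl
length-boundedTuples (suc k) zero    = begin
  length (map (0 ∷_) (boundedTuples k 0))  ≡⟨ length-map _ (boundedTuples k 0) ⟩
  length (boundedTuples k 0)               ≡⟨ length-boundedTuples k 0 ⟩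
  k C k                                    ≡⟨ nCn≡1 k ⟩
  1                                        ≡⟨ nCn≡1 (suc k) ⟨
  suc k C suc k                            ∎
  where open ≡-Reasoning
length-boundedTuples (suc k) (suc s) = begin
  length (map (0 ∷_) (boundedTuples k (suc s)) ++ map incrementHead (boundedTuples (suc k) s))
    ≡⟨ length-++ (map (0 ∷_) (boundedTuples k (suc s))) ⟩
  length (map (0 ∷_) (boundedTuples k (suc s))) + length (map incrementHead (boundedTuples (suc k) s))
    ≡⟨ cong₂ _+_ (length-map _ (boundedTuples k (suc s))) (length-map _ (boundedTuples (suc k) s)) ⟩
  length (boundedTuples k (suc s)) + length (boundedTuples (suc k) s)
    ≡⟨ cong₂ _+_ (length-boundedTuples k (suc s)) (length-boundedTuples (suc k) s) ⟩
  suc (s + k) C k + (s + suc k) C suc k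
    ≡⟨ cong (λ m → suc (s + k) C k + m C suc k) (+-suc s k) ⟩
  suc (s + k) C k + suc (s + k) C suc k
    ≡⟨ nCk+nC[k+1]≡[n+1]C[k+1] (suc (s + k)) k ⟩
  suc (suc (s + k)) C suc k
    ≡⟨ cong (λ m → suc m C suc k) (+-suc s k) ⟨
  (suc s + suc k) C suc k ∎
  where open ≡-Reasoning

padTo-∈-boundedTuples : ∀ n v {c} → sum v ≤ c → padTo n v ∈ boundedTuples n c
padTo-∈-boundedTuples n v {c} h = subst (λ k → padTo n v ∈ boundedTuples k c) (length-padTo n v)
  (∈-boundedTuples (padTo n v) (≤-trans (sum-padTo-≤ n v) h))

∈-fromCoefficients-boundedTuples : ∀ {n c} f → norm f ≡ f → ConstantFree f → length f ≤ suc n → sum f ≤ c →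
                                   f ∈ map fromCoefficients (boundedTuples n c)
∈-fromCoefficients-boundedTuples {n} {c} [] _ _ _ _ =
  subst (_∈ map fromCoefficients (boundedTuples n c)) (fromCoefficients-padTo {n} [] z≤n)
    (∈-map⁺ fromCoefficients (padTo-∈-boundedTuples n [] z≤n))
∈-fromCoefficients-boundedTuples {n} {c} (.0 ∷ v) normal refl (s≤s h) sum≤c =
  subst (_∈ map fromCoefficients (boundedTuples n c)) (trans (fromCoefficients-padTo v h) normal)
    (∈-map⁺ fromCoefficients (padTo-∈-boundedTuples n v sum≤c))

exprsOfDepth< : ℕ → List Expr
exprsOfDepth< zero    = []
exprsOfDepth< (suc d) = var ∷ cartesianProductWith _⊕_ (exprsOfDepth< d) (exprsOfDepth< d)
                           ++ cartesianProductWith _⊗_ (exprsOfDepth< d) (exprsOfDepth< d)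

summands-≤ : ∀ {m n d} → m > 0 → n > 0 → m + n ≤ suc d → m ≤ d × n ≤ d
summands-≤ {m} {n} m>0 n>0 h = ≤-pred (<-≤-trans (m<m+n m n>0) h) , ≤-pred (<-≤-trans (m<n+m n m>0) h)

size≤⇒∈-exprsOfDepth< : ∀ e {d} → size e ≤ d → e ∈ exprsOfDepth< d
size≤⇒∈-exprsOfDepth< e       {zero}  h = contradiction h (<⇒≱ (size>0 e))
size≤⇒∈-exprsOfDepth< var     {suc d} _ = here refl
size≤⇒∈-exprsOfDepth< (a ⊕ b) {suc d} h with summands-≤ (size>0 a) (size>0 b) h
... | a≤d , b≤d =
  there (∈-++⁺ˡ (∈-cartesianProductWith⁺ _⊕_ (size≤⇒∈-exprsOfDepth< a a≤d)
                                                 (size≤⇒∈-exprsOfDepth< b b≤d)))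
size≤⇒∈-exprsOfDepth< (a ⊗ b) {suc d} h with summands-≤ (size>0 a) (size>0 b) h
... | a≤d , b≤d =
  there (∈-++⁺ʳ _ (∈-cartesianProductWith⁺ _⊗_ (size≤⇒∈-exprsOfDepth< a a≤d)
                                                 (size≤⇒∈-exprsOfDepth< b b≤d)))

valuesOfSize : ℕ → List Poly
valuesOfSize j = map eval (filter (λ e → size e ≟ j) (exprsOfDepth< j))

valuesOfSize< : ℕ → List Poly
valuesOfSize< j = map eval (filter (λ e → size e <? j) (exprsOfDepth< j))

K : ℕ → List Poly
K j = deduplicate _≟ₚ_ (filter (λ f → ¬? (f ∈? valuesOfSize< j)) (valuesOfSize j))

K-enumerates : ∀ j → Enumerates (K j) (InK j)
K-enumerates j = deduplicate-! _ , λ f → mk⇔ (sound f) (complete f)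
  where
  new? = λ f → ¬? (f ∈? valuesOfSize< j)

  sound : ∀ f → f ∈ K j → InK j f
  sound f f∈K with ∈-filter⁻ new? {xs = valuesOfSize j} (∈-deduplicate⁻ _≟ₚ_ _ f∈K)
  ... | f∈values , f-new with ∈-map∘filter⁻ eval (λ e → size e ≟ j) {xs = exprsOfDepth< j} f∈values
  ... | e , _ , f≡ , size≡ = (e , size≡ , sym f≡) , minimal
    where
    minimal : ∀ e' → eval e' ≡ f → j ≤ size e'
    minimal e' eval≡ = ≮⇒≥ λ size<j → f-new (∈-map∘filter⁺ eval (λ e → size e <? j)
      (e' , size≤⇒∈-exprsOfDepth< e' (<⇒≤ size<j) , sym eval≡ , size<j))

  complete : ∀ f → InK j f → f ∈ K j
  complete f ((e , size≡ , eval≡) , minimal) = ∈-deduplicate⁺ _≟ₚ_ (∈-filter⁺ new?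
    (∈-map∘filter⁺ eval (λ e → size e ≟ j)
      (e , size≤⇒∈-exprsOfDepth< e (≤-reflexive size≡) , sym eval≡ , size≡))
    not-smaller)
    where
    not-smaller : ¬ (f ∈ valuesOfSize< j)
    not-smaller f∈ with ∈-map∘filter⁻ eval (λ e → size e <? j) {xs = exprsOfDepth< j} f∈
    ... | e' , _ , f≡ , size<j = <⇒≱ size<j (minimal e' (sym f≡))

InK-unique : ∀ {i j f} → InK i f → InK j f → i ≡ j
InK-unique ((e , size≡i , eval≡) , i-minimal) ((e' , size≡j , eval≡') , j-minimal) =
  ≤-antisym (subst (_ ≤_) size≡j (i-minimal e' eval≡')) (subst (_ ≤_) size≡i (j-minimal e eval≡))

∈-K⁻ : ∀ {j f} → f ∈ K j → InK j f
∈-K⁻ {j} {f} = Equivalence.to (proj₂ (K-enumerates j) f)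

K≤ : ℕ → List Poly
K≤ zero    = []
K≤ (suc n) = K≤ n ++ K (suc n)

length-K≤ : ∀ n → length (K≤ n) ≡ sum1to n (λ j → length (K j))
length-K≤ zero    = refl
length-K≤ (suc n) = trans (length-++ (K≤ n)) (cong (_+ length (K (suc n))) (length-K≤ n))

∈-K≤⁻ : ∀ n {f} → f ∈ K≤ n → ∃ λ j → j ≤ n × InK j f
∈-K≤⁻ (suc n) f∈ with ∈-++⁻ (K≤ n) f∈
... | inj₂ f∈K = suc n , ≤-refl , ∈-K⁻ f∈K
... | inj₁ f∈K≤ with ∈-K≤⁻ n f∈K≤
...   | j , j≤n , inK = j , m≤n⇒m≤1+n j≤n , inK

K≤-unique : ∀ n → Unique (K≤ n)
K≤-unique zero    = []
K≤-unique (suc n) = ++⁺ (K≤-unique n) (proj₁ (K-enumerates (suc n))) disjoint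
  where
  disjoint : ∀ {f} → ¬ (f ∈ K≤ n × f ∈ K (suc n))
  disjoint (f∈K≤ , f∈K) with ∈-K≤⁻ n f∈K≤
  ... | j , j≤n , inK = <⇒≢ (s≤s j≤n) (InK-unique inK (∈-K⁻ f∈K))

∈-++-∷⁻ : ∀ {A : Set} {v w : A} us {vs} → v ∈ us ++ w ∷ vs → v ≢ w → v ∈ us ++ vs
∈-++-∷⁻ []       (here v≡w) v≢w = contradiction v≡w v≢w
∈-++-∷⁻ []       (there v∈) _   = v∈
∈-++-∷⁻ (u ∷ us) (here v≡u) _   = here v≡u
∈-++-∷⁻ (u ∷ us) (there v∈) v≢w = there (∈-++-∷⁻ us v∈ v≢w)

Unique-⊆⇒length-≤ : ∀ {A : Set} {xs ys : List A} → Unique xs → xs ⊆ ys → length xs ≤ length ys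
Unique-⊆⇒length-≤ {xs = []}     _             _    = z≤n
Unique-⊆⇒length-≤ {xs = x ∷ xs} (x∉xs ∷ uniq) x∷xs⊆ys with ∈-∃++ (x∷xs⊆ys (here refl))
... | us , vs , refl = begin
  suc (length xs)              ≤⟨ s≤s (Unique-⊆⇒length-≤ uniq xs⊆us++vs) ⟩
  suc (length (us ++ vs))      ≡⟨ cong suc (length-++ us) ⟩
  suc (length us + length vs)  ≡⟨ +-suc (length us) (length vs) ⟨
  length us + length (x ∷ vs)  ≡⟨ length-++ us ⟨
  length (us ++ x ∷ vs)        ∎
  where
  open ≤-Reasoning
  xs⊆us++vs : xs ⊆ us ++ vs
  xs⊆us++vs y∈xs = ∈-++-∷⁻ us (x∷xs⊆ys (there y∈xs)) (λ y≡x → All.lookup x∉xs y∈xs (sym y≡x))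

sum-eval-≤ : ∀ {n c} e → size e ≤ n → 3 ^ n ≤ c ^ 3 → sum (eval e) ≤ c
sum-eval-≤ e size≤n 3ⁿ≤c³ =
  cube-cancel-≤ (≤-trans (sum-eval-cube-≤ e) (≤-trans (^-monoʳ-≤ 3 size≤n) 3ⁿ≤c³))

K≤⊆fromCoefficients : ∀ n c → 3 ^ n ≤ c ^ 3 → K≤ n ⊆ map fromCoefficients (boundedTuples n c)
K≤⊆fromCoefficients n c 3ⁿ≤c³ f∈K≤ with ∈-K≤⁻ n f∈K≤
... | j , j≤n , (e , refl , refl) , _ = ∈-fromCoefficients-boundedTuples (eval e) (eval-normal e)
  (constantFree-eval e) (≤-trans (length-eval e) (s≤s j≤n)) (sum-eval-≤ e j≤n 3ⁿ≤c³)

proposition3p5 : (n : ℕ) → 1 ≤ n → (c : ℕ) → IsCeilCubeRoot (3 ^ n) c →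
    Σ (ℕ → List Poly) λ L →
      (∀ j → 1 ≤ j → j ≤ n → Enumerates (L j) (InK j)) ×
      (sum1to n (λ j → length (L j)) ≤ sum1to c (λ i → (i + n) C n))
proposition3p5 n _ c (3ⁿ≤c³ , _) = K , (λ j _ _ → K-enumerates j) , (begin
  sum1to n (λ j → length (K j))
    ≡⟨ length-K≤ n ⟨
  length (K≤ n)
    ≤⟨ Unique-⊆⇒length-≤ (K≤-unique n) (K≤⊆fromCoefficients n c 3ⁿ≤c³) ⟩
  length (map fromCoefficients (boundedTuples n c))
    ≡⟨ length-map fromCoefficients (boundedTuples n c) ⟩
  length (boundedTuples n c)
    ≡⟨ length-boundedTuples n c ⟩
  (c + n) C n
    ≤⟨ last-term-≤ c 3ⁿ≤c³ ⟩
  sum1to c (λ i → (i + n) C n) ∎)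
  where
  open ≤-Reasoning
  last-term-≤ : ∀ c → 3 ^ n ≤ c ^ 3 → (c + n) C n ≤ sum1to c (λ i → (i + n) C n)
  last-term-≤ zero    3ⁿ≤0 = contradiction 3ⁿ≤0 (<⇒≱ (m^n>0 3 n))
  last-term-≤ (suc c) _    = m≤n+m _ _
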